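{- Fix $k,l,m,n\in\mathbb{N}$ with $k\le m$, $l\le n$, and $k,l$ even. For every set $\Gamma$ of formulas of $\mathcal{L}_{\mathsf{BCL}}$ and every formula $A$: if $\Gamma\vdash_{Ax_{\mathsf{BCL}}^{k,l,m,n}}A$, then $\Gamma\vDash_{\mathbf{R}^{k,l,m,n}}A$.
   Context: $\mathcal{L}_{\mathsf{BCL}}$ has variables $p_0,p_1,\dots$ (set $\mathrm{Var}$), unary $\neg$, binary $\wedge,\vee,\rightarrow$; $\mathrm{For}$ is its set of formulas. $A\supset B:=\neg A\vee B$; $\neg^jA$ is $A$ preceded by $j$ negations ($\neg^0A=A$). A model is a pair $\langle v,R\rangle$ with $v:\mathrm{Var}\to\{0,1\}$ and $R\subseteq\mathrm{For}\times\mathrm{For}$. Truth: $M\vDash p$ iff $v(p)=1$; $M\vDash\neg B$ iff $M\nvDash B$; $M\vDash B\wedge C$ iff both true; $M\vDash B\vee C$ iff at least one true; $M\vDash B\rightarrow C$ iff ($M\nvDash B$ or $M\vDash C$) and $R(B,C)$. Conditions on $R$ (for all formulas $A,B$): (a1) not $R(A,\neg A)$; (a2) not $R(\neg A,A)$; (b0) $R(A,B)\Rightarrow$ not $R(A,\neg B)$; (b1) $R(A\rightarrow B,\neg(A\rightarrow\neg B))$; (b2) $R(A\rightarrow\neg B,\neg(A\rightarrow B))$; (cun) $R(A,B)\Rightarrow R(\neg A,\neg B)$; (cun$^{k,l,m,n}$) $R(\neg^kA,\neg^lB)\Rightarrow R(\neg^mA,\neg^nB)$. $\mathbf{R}^{k,l,m,n}$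 is the class of relations satisfying all of (a1),(a2),(b0),(b1),(b2),(cun),(cun$^{k,l,m,n}$). $\Gamma\vDash_{\mathbf{R}^{k,l,m,n}}A$ means: for every model $\langle v,R\rangle$ with $R\in\mathbf{R}^{k,l,m,n}$, if all members of $\Gamma$ are true in it then $A$ is true in it. $Ax_{\mathsf{BCL}}^{k,l,m,n}$ is the Hilbert system with axiom schemata: (CPL) all substitution instances of classical propositional tautologies; (A1) $\neg(A\rightarrow\neg A)$; (A2) $\neg(\neg A\rightarrow A)$; (B1) $(A\rightarrow B)\rightarrow\neg(A\rightarrow\neg B)$; (B2) $(A\rightarrow\neg B)\rightarrow\neg(A\rightarrow B)$; (Imp) $(A\rightarrow B)\supset(A\supset B)$; (CUN1) $(A\rightarrow B)\supset((\neg A\rightarrow\neg B)\vee(\neg A\wedge B))$; (CUN2) $(A\rightarrow B)\supset(\neg\neg A\rightarrow\neg\neg B)$; (GCUN) $(\neg^kA\rightarrow\neg^lB)\supset((\neg^mA\rightarrow\neg^nB)\vee(\neg^mA\wedge\neg^{n+1}B))$; (GCUN2) $(\neg^kA\rightarrow\neg^lB)\supset(\neg^{2m-k}A\rightarrow\neg^{2n-l}B)$; and the single rule: from $A$ and $A\supset B$ infer $B$. $\Gamma\vdash A$ means $A$ is derivable from axioms and members of $\Gamma$ by this rule. -}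

module Defs where

open import Data.Nat using (ℕ; zero; suc; _*_; _∸_)
open import Data.Bool using (Bool; true; false; not; _∧_; _∨_)
open import Data.Product using (Σ; _×_)
open import Relation.Binary.PropositionalEquality using (_≡_)

data For : Set where
  var  : ℕ → For
  ¬_   : For → For
  _∧'_ : For → For → For
  _∨'_ : For → For → For
  _⇒_  : For → For → For   -- the connexive arrow →

infixr 6 _∧'_
infixr 5 _∨'_
infixr 4 _⇒_ _⊃_
infix 8 ¬_

_⊃_ : For → For → For
A ⊃ B = (¬ A) ∨' B

neg^ : ℕ → For → For
neg^ zero    A = A
neg^ (suc j) A = ¬ (neg^ j A)

data CF : Set where
  cvar : ℕ → CF
  cneg : CF → CF
  cand : CF → CF → CF
  cor  : CF → CF → CF

evalC : (ℕ → Bool) → CF → Bool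
evalC w (cvar i)   = w i
evalC w (cneg φ)   = not (evalC w φ)
evalC w (cand φ ψ) = evalC w φ ∧ evalC w ψ
evalC w (cor φ ψ)  = evalC w φ ∨ evalC w ψ

Tautology : CF → Set
Tautology φ = (w : ℕ → Bool) → evalC w φ ≡ true

subst : (ℕ → For) → CF → For
subst σ (cvar i)   = σ i
subst σ (cneg φ)   = ¬ subst σ φ
subst σ (cand φ ψ) = subst σ φ ∧' subst σ ψ
subst σ (cor φ ψ)  = subst σ φ ∨' subst σ ψ

IsCPL : For → Set
IsCPL A = Σ CF λ φ → Σ (ℕ → For) λ σ → Tautology φ × (subst σ φ ≡ A)

data Deriv (k l m n : ℕ) (Γ : For → Set) : For → Set where
  hyp   : ∀ {A} → Γ A → Deriv k l m n Γ A
  cpl   : ∀ {A} → IsCPL A → Deriv k l m n Γ A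
  ax-A1 : ∀ A → Deriv k l m n Γ (¬ (A ⇒ ¬ A))
  ax-A2 : ∀ A → Deriv k l m n Γ (¬ (¬ A ⇒ A))
  ax-B1 : ∀ A B → Deriv k l m n Γ ((A ⇒ B) ⇒ ¬ (A ⇒ ¬ B))
  ax-B2 : ∀ A B → Deriv k l m n Γ ((A ⇒ ¬ B) ⇒ ¬ (A ⇒ B))
  ax-Imp  : ∀ A B → Deriv k l m n Γ ((A ⇒ B) ⊃ (A ⊃ B))
  ax-CUN1 : ∀ A B → Deriv k l m n Γ ((A ⇒ B) ⊃ ((¬ A ⇒ ¬ B) ∨' (¬ A ∧' B)))
  ax-CUN2 : ∀ A B → Deriv k l m n Γ ((A ⇒ B) ⊃ (¬ ¬ A ⇒ ¬ ¬ B))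
  ax-GCUN : ∀ A B → Deriv k l m n Γ
              ((neg^ k A ⇒ neg^ l B) ⊃
                 ((neg^ m A ⇒ neg^ n B) ∨' (neg^ m A ∧' neg^ (suc n) B)))
  ax-GCUN2 : ∀ A B → Deriv k l m n Γ
              ((neg^ k A ⇒ neg^ l B) ⊃
                 (neg^ (2 * m ∸ k) A ⇒ neg^ (2 * n ∸ l) B))
  mp    : ∀ {A B} → Deriv k l m n Γ A → Deriv k l m n Γ (A ⊃ B) → Deriv k l m n Γ B

record Model : Set where
  field
    v : ℕ → Bool
    R : For → For → Bool

open Model public

⟦_⟧ : Model → For → Bool
⟦ M ⟧ (var i)  = v M i
⟦ M ⟧ (¬ A)    = not (⟦ M ⟧ A)
⟦ M ⟧ (A ∧' B) = ⟦ M ⟧ A ∧ ⟦ M ⟧ B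
⟦ M ⟧ (A ∨' B) = ⟦ M ⟧ A ∨ ⟦ M ⟧ B
⟦ M ⟧ (A ⇒ B)  = (not (⟦ M ⟧ A) ∨ ⟦ M ⟧ B) ∧ R M A B

_⊨_ : Model → For → Set
M ⊨ A = ⟦ M ⟧ A ≡ true

record InRclass (k l m n : ℕ) (R : For → For → Bool) : Set where
  field
    a1  : ∀ A → R A (¬ A) ≡ false
    a2  : ∀ A → R (¬ A) A ≡ false
    b0  : ∀ A B → R A B ≡ true → R A (¬ B) ≡ false
    b1  : ∀ A B → R (A ⇒ B) (¬ (A ⇒ ¬ B)) ≡ true
    b2  : ∀ A B → R (A ⇒ ¬ B) (¬ (A ⇒ B)) ≡ true
    cun : ∀ A B → R A B ≡ true → R (¬ A) (¬ B) ≡ true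
    cunklmn : ∀ A B → R (neg^ k A) (neg^ l B) ≡ true → R (neg^ m A) (neg^ n B) ≡ true

Entails : (k l m n : ℕ) → (For → Set) → For → Set
Entails k l m n Γ A =
  (M : Model) → InRclass k l m n (R M) → (∀ B → Γ B → M ⊨ B) → M ⊨ A

-- An arrow B → C is true exactly when it holds
-- materially and R(B,C). Hence (CUN1) and (GCUN) use only the relevance part of their
-- antecedent: once (cun) or (cun^{k,l,m,n}) transfers R to the new pair (X,Y), the arrow
-- X → Y can fail only where X ∧ ¬Y holds. For (GCUN2), applying (cun^{k,l,m,n}) a second
-- time, to ¬^{m-k}A and ¬^{n-l}B, moves the exponents from m, n to 2m-k, 2n-l; as 2m-k has
-- the parity of k, ¬^{2m-k}A and ¬^k A have the same truth value (likewise for B).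
-- The argument does not use that k and l are even.
module Submission where

open import Defs
open import Data.Nat using (ℕ; _≤_; zero; suc; _+_; _*_; _∸_)
open import Data.Nat.Divisibility using (_∣_)
open import Data.Nat.Properties using (+-identityʳ; +-∸-assoc; m∸n+n≡m; m+[n∸m]≡n)
open import Data.Nat.Tactic.RingSolver using (solve-∀)
open import Data.Bool using (true; false; not; _∧_; _∨_)
open import Data.Bool.Properties using (not-involutive; ∧-identityʳ; ∧-zeroʳ)
open import Data.Product using (_,_)
open import Relation.Nullary using (contradiction)
open import Relation.Binary.PropositionalEquality hiding (subst)
open ≡-Reasoning

2*n∸m≡n+[n∸m] : ∀ {m n} → m ≤ n → 2 * n ∸ m ≡ n + (n ∸ m)
2*n∸m≡n+[n∸m] {m} {n} m≤n =
  trans (cong (λ x → n + x ∸ m) (+-identityʳ n)) (+-∸-assoc n m≤n)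

2*n∸m≡[n∸m]*2+m : ∀ {m n} → m ≤ n → 2 * n ∸ m ≡ (n ∸ m) * 2 + m
2*n∸m≡[n∸m]*2+m {m} {n} m≤n = begin
  2 * n ∸ m              ≡⟨ 2*n∸m≡n+[n∸m] m≤n ⟩
  n + (n ∸ m)            ≡⟨ cong (_+ (n ∸ m)) (sym (m∸n+n≡m m≤n)) ⟩
  (n ∸ m + m) + (n ∸ m)  ≡⟨ regroup (n ∸ m) m ⟩
  (n ∸ m) * 2 + m        ∎
  where
  regroup : ∀ d m → (d + m) + d ≡ d * 2 + m
  regroup = solve-∀

neg^-+ : ∀ i j A → neg^ i (neg^ j A) ≡ neg^ (i + j) A
neg^-+ zero    j A = refl
neg^-+ (suc i) j A = cong ¬_ (neg^-+ i j A)

neg^-split : ∀ {m n} A → m ≤ n → neg^ n A ≡ neg^ m (neg^ (n ∸ m) A)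
neg^-split {m} {n} A m≤n =
  trans (cong (λ j → neg^ j A) (sym (m+[n∸m]≡n m≤n))) (sym (neg^-+ m (n ∸ m) A))

neg^-reflect : ∀ {m n} A → m ≤ n → neg^ (2 * n ∸ m) A ≡ neg^ n (neg^ (n ∸ m) A)
neg^-reflect {m} {n} A m≤n =
  trans (cong (λ j → neg^ j A) (2*n∸m≡n+[n∸m] m≤n)) (sym (neg^-+ n (n ∸ m) A))

-- Stated for truth values rather than formulas: ⟦ M ⟧ is not injective, so formula
-- arguments could not be inferred from goals of the form M ⊨ (A ⊃ B).
⊃-intro : ∀ {a b} → (a ≡ true → b ≡ true) → not a ∨ b ≡ true
⊃-intro {false} _ = refl
⊃-intro {true}  h = h refl

⊃-elim : ∀ {a b} → a ≡ true → not a ∨ b ≡ true → b ≡ true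
⊃-elim refl h = h

module Truth (M : Model) where

  ⇒-intro : ∀ {A B} → R M A B ≡ true → (M ⊨ A → M ⊨ B) → M ⊨ (A ⇒ B)
  ⇒-intro r h rewrite r = trans (∧-identityʳ _) (⊃-intro h)

  ⇒-relevant : ∀ {A B} → M ⊨ (A ⇒ B) → R M A B ≡ true
  ⇒-relevant {A} {B} h with R M A B
  ... | true  = refl
  ... | false = trans (sym (∧-zeroʳ _)) h

  ⇒-material : ∀ {A B} → M ⊨ (A ⇒ B) → M ⊨ (A ⊃ B)
  ⇒-material {A} {B} h with not (⟦ M ⟧ A) ∨ ⟦ M ⟧ B
  ... | true  = refl
  ... | false = h

  ¬⇒-irrelevant : ∀ {A B} → R M A B ≡ false → M ⊨ (¬ (A ⇒ B))
  ¬⇒-irrelevant {A} {B} r rewrite r | ∧-zeroʳ (not (⟦ M ⟧ A) ∨ ⟦ M ⟧ B) = refl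

  ⇒-transfer : ∀ {A B A′ B′} → R M A′ B′ ≡ true →
               ⟦ M ⟧ A′ ≡ ⟦ M ⟧ A → ⟦ M ⟧ B′ ≡ ⟦ M ⟧ B → M ⊨ (A ⇒ B) → M ⊨ (A′ ⇒ B′)
  ⇒-transfer r A′≡A B′≡B h =
    ⇒-intro r (λ a′ → trans B′≡B (⊃-elim (trans (sym A′≡A) a′) (⇒-material h)))

  ⇒-or-counterexample : ∀ {A B C} → R M A B ≡ true → ⟦ M ⟧ C ≡ not (⟦ M ⟧ B) →
                        M ⊨ ((A ⇒ B) ∨' (A ∧' C))
  ⇒-or-counterexample {A} {B} r C≡¬B rewrite r | C≡¬B with ⟦ M ⟧ A | ⟦ M ⟧ B
  ... | true  | true  = refl
  ... | true  | false = refl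
  ... | false | _     = refl

  ⟦⟧-neg^-+-even : ∀ d i A → ⟦ M ⟧ (neg^ (d * 2 + i) A) ≡ ⟦ M ⟧ (neg^ i A)
  ⟦⟧-neg^-+-even zero    i A = refl
  ⟦⟧-neg^-+-even (suc d) i A = trans (not-involutive _) (⟦⟧-neg^-+-even d i A)

  ⟦⟧-neg^-reflect : ∀ {m n} A → m ≤ n → ⟦ M ⟧ (neg^ (2 * n ∸ m) A) ≡ ⟦ M ⟧ (neg^ m A)
  ⟦⟧-neg^-reflect {m} {n} A m≤n =
    trans (cong (λ j → ⟦ M ⟧ (neg^ j A)) (2*n∸m≡[n∸m]*2+m m≤n)) (⟦⟧-neg^-+-even (n ∸ m) m A)

  ⟦⟧-subst : ∀ σ φ → ⟦ M ⟧ (subst σ φ) ≡ evalC (λ i → ⟦ M ⟧ (σ i)) φ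
  ⟦⟧-subst σ (cvar i)   = refl
  ⟦⟧-subst σ (cneg φ)   = cong not (⟦⟧-subst σ φ)
  ⟦⟧-subst σ (cand φ ψ) = cong₂ _∧_ (⟦⟧-subst σ φ) (⟦⟧-subst σ ψ)
  ⟦⟧-subst σ (cor φ ψ)  = cong₂ _∨_ (⟦⟧-subst σ φ) (⟦⟧-subst σ ψ)

  ⊨-IsCPL : ∀ {A} → IsCPL A → M ⊨ A
  ⊨-IsCPL (φ , σ , taut , refl) = trans (⟦⟧-subst σ φ) (taut _)

module Soundness {k l m n : ℕ} (k≤m : k ≤ m) (l≤n : l ≤ n)
                 (M : Model) (RM : InRclass k l m n (R M)) where
  open InRclass RM
  open Truth M

  b0-¬ : ∀ {A B} → R M A (¬ B) ≡ true → R M A B ≡ false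
  b0-¬ {A} {B} r with R M A B in e
  ... | false = refl
  ... | true  = contradiction (trans (sym r) (b0 A B e)) λ ()

  cunklmn-reflect : ∀ {A B} → R M (neg^ k A) (neg^ l B) ≡ true →
                    R M (neg^ (2 * m ∸ k) A) (neg^ (2 * n ∸ l) B) ≡ true
  cunklmn-reflect {A} {B} r =
    subst₂ Related (sym (neg^-reflect A k≤m)) (sym (neg^-reflect B l≤n))
      (cunklmn (neg^ (m ∸ k) A) (neg^ (n ∸ l) B)
        (subst₂ Related (neg^-split A k≤m) (neg^-split B l≤n) (cunklmn A B r)))
    where
    Related : For → For → Set
    Related X Y = R M X Y ≡ true

  sound : ∀ {Γ A} → Deriv k l m n Γ A → (∀ B → Γ B → M ⊨ B) → M ⊨ A
  sound (hyp ΓA)       ⊨Γ = ⊨Γ _ ΓA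
  sound (cpl cplA)     _  = ⊨-IsCPL cplA
  sound (ax-A1 A)      _  = ¬⇒-irrelevant (a1 A)
  sound (ax-A2 A)      _  = ¬⇒-irrelevant (a2 A)
  sound (ax-B1 A B)    _  = ⇒-intro (b1 A B) λ h → ¬⇒-irrelevant (b0 A B (⇒-relevant h))
  sound (ax-B2 A B)    _  = ⇒-intro (b2 A B) λ h → ¬⇒-irrelevant (b0-¬ (⇒-relevant h))
  sound (ax-Imp A B)   _  = ⊃-intro λ (h : M ⊨ (A ⇒ B)) → ⇒-material h
  sound (ax-CUN1 A B)  _  = ⊃-intro λ (h : M ⊨ (A ⇒ B)) →
    ⇒-or-counterexample {C = B} (cun A B (⇒-relevant h)) (sym (not-involutive _))
  sound (ax-CUN2 A B)  _  = ⊃-intro λ (h : M ⊨ (A ⇒ B)) →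
    ⇒-transfer (cun (¬ A) (¬ B) (cun A B (⇒-relevant h)))
               (not-involutive _) (not-involutive _) h
  sound (ax-GCUN A B)  _  = ⊃-intro λ (h : M ⊨ (neg^ k A ⇒ neg^ l B)) →
    ⇒-or-counterexample {C = neg^ (suc n) B} (cunklmn A B (⇒-relevant h)) refl
  sound (ax-GCUN2 A B) _  = ⊃-intro λ (h : M ⊨ (neg^ k A ⇒ neg^ l B)) →
    ⇒-transfer (cunklmn-reflect (⇒-relevant h))
               (⟦⟧-neg^-reflect A k≤m) (⟦⟧-neg^-reflect B l≤n) h
  sound (mp ⊢A ⊢A⊃B)   ⊨Γ = ⊃-elim (sound ⊢A ⊨Γ) (sound ⊢A⊃B ⊨Γ)

mainTheorem3 : (k l m n : ℕ) → k ≤ m → l ≤ n → 2 ∣ k → 2 ∣ l →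
    (Γ : For → Set) (A : For) → Deriv k l m n Γ A → Entails k l m n Γ A
mainTheorem3 k l m n k≤m l≤n _ _ Γ A ⊢A M RM ⊨Γ = Soundness.sound k≤m l≤n M RM ⊢A ⊨Γ
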